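{- Let $b$ be a positive integer. Then $h_{0,1}(x) = 1$, and if $b \ge 2$ then $$h_{0,b}(x) = 1 + \frac{x\, h_{0,b-1}(x)}{1 - x -\cdots - x^{b-1}}.$$
   Context: $S_n$ is the set of permutations of $\{1,\dots,n\}$ in one-line notation; $\pi$ avoids $\sigma\in S_k$ if no subsequence of $\pi$ of length $k$ has the same relative order as $\sigma$; $S_n(R)$ is the set of $\pi\in S_n$ avoiding every element of $R$, and $S_0(R)$ contains only the empty permutation. For nonnegative integers $a,b$, $\mu_{a,b}\in S_{a+b}$ is $\mu_{a,b} = b+a, b+a-1, \ldots, b+1, 1, 2, \ldots, b$ (so $\mu_{0,b} = 12\ldots b$), and $h_{a,b}(x) = \sum_{n\ge0} |S_n(132, 3241, \mu_{a,b})| x^n$. -}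

module Defs where

open import Data.Bool using (Bool; true; false; not; _∧_; _∨_; if_then_else_)
open import Data.Nat as ℕ using (ℕ; zero; suc; _∸_; _<ᵇ_; _≡ᵇ_)
open import Data.Integer as ℤ using (ℤ; +_)
open import Data.List using (List; []; _∷_; _++_; map; concatMap; filterᵇ; length; upTo; downFrom; zip)
open import Data.Bool.ListAction using (all; any)
open import Data.Product using (_,_)
open import Relation.Binary.PropositionalEquality using (_≡_)

words : ℕ → ℕ → List (List ℕ)
words m zero    = [] ∷ []
words m (suc k) = concatMap (λ w → map (λ x → x ∷ w) (map suc (upTo m))) (words m k)

distinctᵇ : List ℕ → Bool
distinctᵇ []       = true
distinctᵇ (x ∷ xs) = not (any (λ y → x ≡ᵇ y) xs) ∧ distinctᵇ xs

S : ℕ → List (List ℕ)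
S n = filterᵇ distinctᵇ (words n n)

subseqs : List ℕ → List (List ℕ)
subseqs []       = [] ∷ []
subseqs (x ∷ xs) = map (x ∷_) (subseqs xs) ++ subseqs xs

_⇔ᵇ_ : Bool → Bool → Bool
true  ⇔ᵇ b = b
false ⇔ᵇ b = not b

-- same relative order (same length and for all positions i < j,
-- u_i < u_j iff v_i < v_j; entries are distinct in our uses)
sameOrderᵇ : List ℕ → List ℕ → Bool
sameOrderᵇ []       []       = true
sameOrderᵇ (x ∷ xs) (y ∷ ys) =
  all (λ { (z , w) → (x <ᵇ z) ⇔ᵇ (y <ᵇ w) }) (zip xs ys) ∧ sameOrderᵇ xs ys
sameOrderᵇ _        _        = false

containsᵇ : List ℕ → List ℕ → Bool
containsᵇ π σ = any (λ s → sameOrderᵇ s σ) (subseqs π)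

avoidsAllᵇ : List ℕ → List (List ℕ) → Bool
avoidsAllᵇ π R = all (λ σ → not (containsᵇ π σ)) R

countAvoiders : ℕ → List (List ℕ) → ℕ
countAvoiders n R = length (filterᵇ (λ π → avoidsAllᵇ π R) (S n))

μ : ℕ → ℕ → List ℕ
μ a b = map (λ i → b ℕ.+ suc i) (downFrom a) ++ map suc (upTo b)

p132 : List ℕ
p132 = 1 ∷ 3 ∷ 2 ∷ []

p3241 : List ℕ
p3241 = 3 ∷ 2 ∷ 4 ∷ 1 ∷ []

FPS : Set
FPS = ℕ → ℤ

_≈_ : FPS → FPS → Set
f ≈ g = ∀ n → f n ≡ g n

infix 4 _≈_

sumℤ : List ℤ → ℤ
sumℤ []       = + 0
sumℤ (x ∷ xs) = x ℤ.+ sumℤ xs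

_⊕_ : FPS → FPS → FPS
(f ⊕ g) n = f n ℤ.+ g n

_⊖_ : FPS → FPS → FPS
(f ⊖ g) n = f n ℤ.- g n

_⊛_ : FPS → FPS → FPS
(f ⊛ g) n = sumℤ (map (λ k → f k ℤ.* g (n ∸ k)) (upTo (suc n)))

infixl 7 _⊛_
infixl 6 _⊕_ _⊖_

one : FPS
one zero    = + 1
one (suc _) = + 0

X : FPS
X (suc zero) = + 1
X _          = + 0

-- 1 - x - x^2 - ... - x^(b-1)
D : ℕ → FPS
D b zero    = + 1
D b (suc k) = if suc k <ᵇ b then ℤ.- (+ 1) else + 0

h : ℕ → ℕ → FPS
h a b n = + countAvoiders n (p132 ∷ p3241 ∷ μ a b ∷ [])

-- Split an avoider π of length n+1 at its maximum, π = α (n+1) β.  Avoiding 132 puts every entry of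
-- α above every entry of β.  If β is empty, α is an arbitrary avoider of length n with b−1 in place of b.
-- Otherwise, with n+1 and an entry of β playing 4 and 1, avoiding 3241 forces α to increase, so α (n+1)
-- is the run m+1, …, n+1 where m = |β| ≥ 1; avoiding 12…b bounds its length n+1−m by b−1, and β is an
-- arbitrary avoider of length m.  Hence the coefficients f_b(n) of h_{0,b} satisfy
-- f_b(n+1) = f_{b−1}(n) + Σ_{1 ≤ m ≤ n, n+1−m < b} f_b(m), the coefficient form of
-- (h_{0,b} − 1)(1 − x − ⋯ − x^{b−1}) = x h_{0,b−1}.

module Submission where

open import Defs
open import Data.Bool using (true; false; T; T?; not; if_then_else_)
open import Data.Bool.ListAction using (any)
open import Data.Bool.Properties using (T-∧)
open import Data.Empty using (⊥; ⊥-elim)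
open import Data.Integer as ℤ using (ℤ; +_)
import Data.Integer.Properties as ℤ
open import Data.List using (List; []; _∷_; _++_; [_]; length; map; take; zip; drop; last; upTo; filterᵇ; concatMap)
open import Data.List.Membership.Propositional using (_∈_; _∉_; find)
open import Data.List.Membership.Propositional.Properties
  using (∈-++⁺ˡ; ∈-++⁺ʳ; ∈-++⁻; ∈-map⁺; ∈-map⁻; ∈-insert; ∈-∃++; ∈-concatMap⁺; ∈-concatMap⁻;
         ∈-upTo⁺; ∈-upTo⁻; ∈-filter⁺; ∈-filter⁻)
open import Data.List.Membership.Propositional.Properties.WithK using (unique∧set⇒bag)
open import Data.List.Properties
  using (++-assoc; ++-identityʳ; ++-cancelˡ; ∷-injective; ∷-injectiveˡ; ∷ʳ-injective; ∷ʳ-injectiveˡ;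
         length-map; length-upTo; length-++; length-++-sucʳ; length-take;
         map-cong; map-cong-local; map-++; map-upTo; map-applyUpTo; upTo-∷ʳ)
open import Data.List.Relation.Binary.BagAndSetEquality using (∼bag⇒↭)
open import Data.List.Relation.Binary.Disjoint.Propositional using (Disjoint)
open import Data.List.Relation.Binary.Permutation.Propositional.Properties using (↭-length)
open import Data.List.Relation.Binary.Sublist.Propositional
  using (_⊆_; []; _∷_; _∷ʳ_; ⊆-refl; ⊆-trans; minimum; from∈; lookup)
open import Data.List.Relation.Binary.Sublist.Propositional.Properties
  using (All-resp-⊆; take-⊆; ++⁺; ++⁺ˡ; ++⁺ʳ; length-mono-≤)
open import Data.List.Relation.Unary.All as All using (All; []; _∷_)
import Data.List.Relation.Unary.All.Properties as Allₚ
open import Data.List.Relation.Unary.AllPairs as AllPairs using (AllPairs; []; _∷_)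
import Data.List.Relation.Unary.AllPairs.Properties as AllPairsₚ
open import Data.List.Relation.Unary.Any as Any using (here; there)
open import Data.List.Relation.Unary.Any.Properties using (any⁺; any⁻)
open import Data.List.Relation.Unary.Unique.Propositional using (Unique)
import Data.List.Relation.Unary.Unique.Propositional.Properties as Unique
open import Data.Maybe using (just)
open import Data.Nat using (ℕ; zero; suc; _+_; _∸_; _<_; _≤_; _<ᵇ_; _≡ᵇ_; z≤n; s≤s; s≤s⁻¹; z<s; _<?_; _≟_)
open import Data.List.Membership.DecPropositional _≟_ using (_∈?_)
open import Data.Nat.Properties
open import Data.Product using (_×_; _,_; proj₁; proj₂; ∃-syntax; ∃₂)
open import Data.Sum using (_⊎_; inj₁; inj₂)
open import Data.Unit using (tt)
open import Function using (_∘_; id)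
open import Function.Bundles using (Equivalence; mk⇔)
open import Relation.Binary.PropositionalEquality hiding ([_])
open import Relation.Nullary using (¬_; yes; no)
open import Relation.Nullary.Reflects using (ofʸ; ofⁿ)

AllPairs-resp-⊆ : ∀ {A : Set} {R : A → A → Set} {s xs : List A} → s ⊆ xs → AllPairs R xs → AllPairs R s
AllPairs-resp-⊆ []            []         = []
AllPairs-resp-⊆ (_ ∷ʳ s⊆xs)   (_ ∷ rxs)  = AllPairs-resp-⊆ s⊆xs rxs
AllPairs-resp-⊆ (refl ∷ s⊆xs) (rx ∷ rxs) = All-resp-⊆ s⊆xs rx ∷ AllPairs-resp-⊆ s⊆xs rxs

pairs⇒AllPairs : ∀ {A : Set} {R : A → A → Set} {xs} → (∀ {x z} → (x ∷ z ∷ []) ⊆ xs → R x z) → AllPairs R xs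
pairs⇒AllPairs {xs = []}     _     = []
pairs⇒AllPairs {xs = x ∷ xs} pairs =
  All.tabulate (λ z∈ → pairs (refl ∷ from∈ z∈)) ∷ pairs⇒AllPairs (λ xz⊆ → pairs (x ∷ʳ xz⊆))

⊆-++⁻ : ∀ {A : Set} (xs : List A) {ys s} → s ⊆ xs ++ ys →
        ∃₂ λ s₁ s₂ → s ≡ s₁ ++ s₂ × s₁ ⊆ xs × s₂ ⊆ ys
⊆-++⁻ []       {s = s} s⊆ys = [] , s , refl , [] , s⊆ys
⊆-++⁻ (x ∷ xs) (_ ∷ʳ s⊆)
  with s₁ , s₂ , refl , s₁⊆ , s₂⊆ ← ⊆-++⁻ xs s⊆ = s₁ , s₂ , refl , x ∷ʳ s₁⊆ , s₂⊆
⊆-++⁻ (x ∷ xs) (refl ∷ s⊆)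
  with s₁ , s₂ , refl , s₁⊆ , s₂⊆ ← ⊆-++⁻ xs s⊆ = x ∷ s₁ , s₂ , refl , refl ∷ s₁⊆ , s₂⊆

⊆-∷ʳ⁻ : ∀ {A : Set} (xs : List A) {x s} → s ⊆ xs ++ [ x ] → s ⊆ xs ⊎ ∃[ s′ ] s ≡ s′ ++ [ x ] × s′ ⊆ xs
⊆-∷ʳ⁻ xs s⊆ with ⊆-++⁻ xs s⊆
... | s₁ , []        , refl , s₁⊆ , _         = inj₁ (subst (_⊆ xs) (sym (++-identityʳ s₁)) s₁⊆)
... | s₁ , _ ∷ []    , refl , s₁⊆ , refl ∷ [] = inj₂ (s₁ , refl , s₁⊆)
... | _  , _ ∷ _     , _    , _   , _ ∷ʳ ()
... | _  , _ ∷ _ ∷ _ , _    , _   , _ ∷ ()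

∈-delete : ∀ {A : Set} (p : List A) {x q z} → z ∈ p ++ x ∷ q → z ≢ x → z ∈ p ++ q
∈-delete []      (here z≡x) z≢x = ⊥-elim (z≢x z≡x)
∈-delete []      (there z∈) _   = z∈
∈-delete (y ∷ p) (here z≡y) _   = here z≡y
∈-delete (y ∷ p) (there z∈) z≢x = there (∈-delete p z∈ z≢x)

Unique⇒length≤ : ∀ {A : Set} {xs ys : List A} → Unique xs → (∀ {z} → z ∈ xs → z ∈ ys) → length xs ≤ length ys
Unique⇒length≤ {xs = []}     _          _     = z≤n
Unique⇒length≤ {xs = x ∷ xs} (x∉ ∷ xs!) xs⊆ys with p , q , refl ← ∈-∃++ (xs⊆ys (here refl)) =
  subst (suc (length xs) ≤_) (sym (length-++-sucʳ p x q))
    (s≤s (Unique⇒length≤ xs! (λ z∈ → ∈-delete p (xs⊆ys (there z∈)) (All.lookup x∉ z∈ ∘ sym))))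

unique-middle : ∀ {A : Set} (α : List A) {x β} → Unique (α ++ x ∷ β) → All (x ≢_) (α ++ β)
unique-middle []      (x∉β ∷ _)   = x∉β
unique-middle (a ∷ α) (a∉ ∷ rest) = (λ x≡a → All.lookup a∉ (∈-insert α) (sym x≡a)) ∷ unique-middle α rest

AllPairs-++-cross : ∀ {A : Set} {R : A → A → Set} (xs : List A) {ys x y} →
                    AllPairs R (xs ++ ys) → x ∈ xs → y ∈ ys → R x y
AllPairs-++-cross (_ ∷ xs) (Rx ∷ _)   (here refl) y∈ = All.lookup Rx (∈-++⁺ʳ xs y∈)
AllPairs-++-cross (_ ∷ xs) (_ ∷ Rxs) (there x∈)  y∈ = AllPairs-++-cross xs Rxs x∈ y∈

unique-concatMap : ∀ {A B : Set} (f : A → List B) (index : B → A) {xs} → Unique xs →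
                   (∀ {x} → x ∈ xs → Unique (f x)) → (∀ {x z} → x ∈ xs → z ∈ f x → index z ≡ x) →
                   Unique (concatMap f xs)
unique-concatMap f index {[]}     _          _  _       = []
unique-concatMap f index {x ∷ xs} (x∉ ∷ xs!) f! index-f =
  Unique.++⁺ (f! (here refl)) (unique-concatMap f index xs! (f! ∘ there) (index-f ∘ there)) disjoint
  where
  disjoint : Disjoint (f x) (concatMap f xs)
  disjoint (z∈fx , z∈rest) with y , y∈ , z∈fy ← find (∈-concatMap⁻ f z∈rest) =
    All.lookup x∉ y∈ (trans (sym (index-f (here refl) z∈fx)) (index-f (there y∈) z∈fy))

last-++ : ∀ {A : Set} (xs : List A) {y ys} → last (xs ++ y ∷ ys) ≡ last (y ∷ ys)
last-++ []            = refl
last-++ (_ ∷ [])      = refl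
last-++ (_ ∷ x′ ∷ xs) = last-++ (x′ ∷ xs)

last-∈ : ∀ {A : Set} {x : A} ys → last ys ≡ just x → x ∈ ys
last-∈ (_ ∷ [])      refl = here refl
last-∈ (_ ∷ y′ ∷ ys) eq   = there (last-∈ (y′ ∷ ys) eq)

Increasing : List ℕ → Set
Increasing = AllPairs _<_

InRange : ℕ → ℕ → ℕ → Set
InRange lo hi x = lo ≤ x × x < hi

interval : ℕ → ℕ → List ℕ
interval a zero    = []
interval a (suc k) = a ∷ interval (suc a) k

length-interval : ∀ a k → length (interval a k) ≡ k
length-interval a zero    = refl
length-interval a (suc k) = cong suc (length-interval (suc a) k)

interval-InRange : ∀ a k → All (InRange a (a + k)) (interval a k)
interval-InRange a zero    = []
interval-InRange a (suc k) = (≤-refl , m<m+n a z<s)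
  ∷ All.map (λ (a<x , x<) → <⇒≤ a<x , <-≤-trans x< (≤-reflexive (sym (+-suc a k)))) (interval-InRange (suc a) k)

∈-interval : ∀ a k {x} → InRange a (a + k) x → x ∈ interval a k
∈-interval a zero    (a≤x , x<a+0) = ⊥-elim (<⇒≱ (<-≤-trans x<a+0 (≤-reflexive (+-identityʳ a))) a≤x)
∈-interval a (suc k) (a≤x , x<) with m≤n⇒m<n∨m≡n a≤x
... | inj₂ refl = here refl
... | inj₁ a<x  = there (∈-interval (suc a) k (a<x , <-≤-trans x< (≤-reflexive (+-suc a k))))

interval-increasing : ∀ a k → Increasing (interval a k)
interval-increasing a zero    = []
interval-increasing a (suc k) = All.map proj₁ (interval-InRange (suc a) k) ∷ interval-increasing (suc a) k

interval-∷ʳ : ∀ a k → interval a k ++ [ a + k ] ≡ interval a (suc k)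
interval-∷ʳ a zero    = cong [_] (+-identityʳ a)
interval-∷ʳ a (suc k) = cong (a ∷_) (trans (cong (λ t → interval (suc a) k ++ [ t ]) (+-suc a k)) (interval-∷ʳ (suc a) k))

length-unique-in-range : ∀ {lo hi xs} → lo ≤ hi → Unique xs → All (InRange lo hi) xs → length xs + lo ≤ hi
length-unique-in-range {lo} {hi} {xs} lo≤hi xs! bounds = begin
  length xs + lo                        ≤⟨ +-monoˡ-≤ lo (Unique⇒length≤ xs! xs⊆interval) ⟩
  length (interval lo (hi ∸ lo)) + lo   ≡⟨ cong (_+ lo) (length-interval lo (hi ∸ lo)) ⟩
  hi ∸ lo + lo                          ≡⟨ m∸n+n≡m lo≤hi ⟩
  hi                                    ∎
  where
  open ≤-Reasoning
  xs⊆interval : ∀ {x} → x ∈ xs → x ∈ interval lo (hi ∸ lo)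
  xs⊆interval x∈ with lo≤x , x<hi ← All.lookup bounds x∈ =
    ∈-interval lo (hi ∸ lo) (lo≤x , <-≤-trans x<hi (≤-reflexive (sym (m+[n∸m]≡n lo≤hi))))

increasing⇒interval : ∀ a k {xs} → Increasing xs → All (InRange a (a + k)) xs → length xs ≡ k → xs ≡ interval a k
increasing⇒interval a zero    {[]}     _          _                   _ = refl
increasing⇒interval a (suc k) {x ∷ xs} (x<xs ∷ xs↑) ((a≤x , x<hi) ∷ bounds) l =
  cong₂ _∷_ x≡a (increasing⇒interval (suc a) k xs↑ bounds′ (suc-injective l))
  where
  xs-above : All (InRange (suc x) (a + suc k)) xs
  xs-above = All.zipWith (λ (x<y , _ , y<) → x<y , y<) (x<xs , bounds)
  x≤a : x ≤ a
  x≤a = ≤-pred (+-cancelʳ-≤ k (suc x) (suc a) (begin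
    suc x + k          ≡⟨ +-comm (suc x) k ⟩
    k + suc x          ≡⟨ cong (_+ suc x) (suc-injective l) ⟨
    length xs + suc x  ≤⟨ length-unique-in-range x<hi (AllPairs.map <⇒≢ xs↑) xs-above ⟩
    a + suc k          ≡⟨ +-suc a k ⟩
    suc a + k          ∎))
    where open ≤-Reasoning
  x≡a : x ≡ a
  x≡a = ≤-antisym x≤a a≤x
  bounds′ : All (InRange (suc a) (suc a + k)) xs
  bounds′ = All.map (λ (x<y , y<) → ≤-trans (≤-reflexive (cong suc (sym x≡a))) x<y ,
                                     <-≤-trans y< (≤-reflexive (+-suc a k)))
                    xs-above

<ᵇ-true : ∀ {m n} → m < n → (m <ᵇ n) ≡ true
<ᵇ-true {zero}  {suc n} _         = refl
<ᵇ-true {suc m} {suc n} (s≤s m<n) = <ᵇ-true m<n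

<ᵇ-false : ∀ {m n} → n ≤ m → (m <ᵇ n) ≡ false
<ᵇ-false {n = zero}      _         = refl
<ᵇ-false {suc m} {suc n} (s≤s n≤m) = <ᵇ-false n≤m

T-⇔ᵇ⇒≡ : ∀ {x y} → T (x ⇔ᵇ y) → x ≡ y
T-⇔ᵇ⇒≡ {true}  {true}  _ = refl
T-⇔ᵇ⇒≡ {false} {false} _ = refl

T-not⇒¬T : ∀ {b} → T (not b) → ¬ T b
T-not⇒¬T {false} _ ()

¬T⇒T-not : ∀ {b} → ¬ T b → T (not b)
¬T⇒T-not {false} _  = tt
¬T⇒T-not {true}  ¬t = ¬t tt

⊆⇒∈-subseqs : ∀ {s xs : List ℕ} → s ⊆ xs → s ∈ subseqs xs
⊆⇒∈-subseqs []                       = here refl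
⊆⇒∈-subseqs {xs = y ∷ ys} (_ ∷ʳ s⊆)  = ∈-++⁺ʳ (map (y ∷_) (subseqs ys)) (⊆⇒∈-subseqs s⊆)
⊆⇒∈-subseqs (refl ∷ s⊆)              = ∈-++⁺ˡ (∈-map⁺ _ (⊆⇒∈-subseqs s⊆))

∈-subseqs⇒⊆ : ∀ {s} xs → s ∈ subseqs xs → s ⊆ xs
∈-subseqs⇒⊆ []       (here refl) = []
∈-subseqs⇒⊆ (y ∷ ys) s∈ with ∈-++⁻ (map (y ∷_) (subseqs ys)) s∈
... | inj₂ s∈ys = y ∷ʳ ∈-subseqs⇒⊆ ys s∈ys
... | inj₁ s∈yys with _ , t∈ , refl ← ∈-map⁻ (y ∷_) s∈yys = refl ∷ ∈-subseqs⇒⊆ ys t∈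

containsᵇ⁺ : ∀ {s π σ} → s ⊆ π → T (sameOrderᵇ s σ) → T (containsᵇ π σ)
containsᵇ⁺ s⊆π so = any⁺ _ (Any.map (λ { refl → so }) (⊆⇒∈-subseqs s⊆π))

containsᵇ⁻ : ∀ π {σ} → T (containsᵇ π σ) → ∃[ s ] s ⊆ π × T (sameOrderᵇ s σ)
containsᵇ⁻ π c with s , s∈ , so ← find (any⁻ _ (subseqs π) c) = s , ∈-subseqs⇒⊆ π s∈ , so

sameOrder⇒length≡ : ∀ s t → T (sameOrderᵇ s t) → length s ≡ length t
sameOrder⇒length≡ []      []      _  = refl
sameOrder⇒length≡ (x ∷ s) (y ∷ t) so = cong suc (sameOrder⇒length≡ s t (proj₂ (Equivalence.to T-∧ so)))

All-zip⁺ : ∀ {P Q : ℕ → Set} {R : ℕ × ℕ → Set} {xs ys} →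
           (∀ {z w} → P z → Q w → R (z , w)) → All P xs → All Q ys → All R (zip xs ys)
All-zip⁺ f []         _          = []
All-zip⁺ f (_ ∷ _)    []         = []
All-zip⁺ f (pz ∷ pzs) (qw ∷ qws) = f pz qw ∷ All-zip⁺ f pzs qws

All-zip⁻ : ∀ {P Q : ℕ → Set} {R : ℕ × ℕ → Set} {xs ys} → (∀ {z w} → R (z , w) → Q w → P z) →
           length xs ≡ length ys → All R (zip xs ys) → All Q ys → All P xs
All-zip⁻ {xs = []}    {[]}    f _ _          _          = []
All-zip⁻ {xs = _ ∷ _} {_ ∷ _} f l (r ∷ rs) (qw ∷ qws) = f r qw ∷ All-zip⁻ f (suc-injective l) rs qws

sameOrder-increasing⁺ : ∀ {s t} → length s ≡ length t → Increasing s → Increasing t → T (sameOrderᵇ s t)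
sameOrder-increasing⁺ {[]}    {[]}    _ _ _ = tt
sameOrder-increasing⁺ {x ∷ s} {y ∷ t} l (x< ∷ s↑) (y< ∷ t↑) =
  Equivalence.from T-∧ (Allₚ.all⁻ _ (All-zip⁺ same x< y<) , sameOrder-increasing⁺ (suc-injective l) s↑ t↑)
  where
  same : ∀ {z w} → x < z → y < w → T ((x <ᵇ z) ⇔ᵇ (y <ᵇ w))
  same x<z y<w rewrite <ᵇ-true x<z | <ᵇ-true y<w = tt

sameOrder-increasing⁻ : ∀ {s t} → Increasing t → T (sameOrderᵇ s t) → Increasing s
sameOrder-increasing⁻ {[]}    {[]}    _          _  = []
sameOrder-increasing⁻ {x ∷ s} {y ∷ t} (y< ∷ t↑) so =
  All-zip⁻ same (sameOrder⇒length≡ s t so′) (Allₚ.all⁺ _ _ row) y< ∷ sameOrder-increasing⁻ t↑ so′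
  where
  row = proj₁ (Equivalence.to T-∧ so)
  so′ = proj₂ (Equivalence.to T-∧ so)
  same : ∀ {z w} → T ((x <ᵇ z) ⇔ᵇ (y <ᵇ w)) → y < w → x < z
  same {z} e y<w = <ᵇ⇒< x z (subst T (sym (T-⇔ᵇ⇒≡ e)) (<⇒<ᵇ y<w))

sameOrder-132⁺ : ∀ {a b c} → a < c → c ≤ b → T (sameOrderᵇ (a ∷ b ∷ c ∷ []) p132)
sameOrder-132⁺ a<c c≤b rewrite <ᵇ-true (<-≤-trans a<c c≤b) | <ᵇ-true a<c | <ᵇ-false c≤b = tt

sameOrder-132⁻ : ∀ {a b c} → T (sameOrderᵇ (a ∷ b ∷ c ∷ []) p132) → a < c × c ≤ b
sameOrder-132⁻ {a} {b} {c} so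
  with a <ᵇ b | a <ᵇ c | <ᵇ-reflects-< a c | b <ᵇ c | <ᵇ-reflects-< b c
... | true  | true  | ofʸ a<c | false | ofⁿ b≮c = a<c , ≮⇒≥ b≮c
... | false | _     | _       | _     | _       = ⊥-elim so
... | true  | false | _       | _     | _       = ⊥-elim so
... | true  | true  | _       | true  | _       = ⊥-elim so

sameOrder-3241⁺ : ∀ {a b c d} → d ≤ b → b ≤ a → a < c → T (sameOrderᵇ (a ∷ b ∷ c ∷ d ∷ []) p3241)
sameOrder-3241⁺ d≤b b≤a a<c
  rewrite <ᵇ-false b≤a | <ᵇ-true a<c | <ᵇ-false (≤-trans d≤b b≤a) | <ᵇ-true (≤-<-trans b≤a a<c)
        | <ᵇ-false d≤b | <ᵇ-false (≤-trans d≤b (≤-trans b≤a (<⇒≤ a<c))) = tt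

sameOrder-3241⁻ : ∀ {a b c d} → T (sameOrderᵇ (a ∷ b ∷ c ∷ d ∷ []) p3241) → d ≤ b × b ≤ a × a < c
sameOrder-3241⁻ {a} {b} {c} {d} so
  with a <ᵇ b | <ᵇ-reflects-< a b | a <ᵇ c | <ᵇ-reflects-< a c | a <ᵇ d | b <ᵇ c | b <ᵇ d | <ᵇ-reflects-< b d | c <ᵇ d
... | false | ofⁿ a≮b | true  | ofʸ a<c | false | true  | false | ofⁿ b≮d | false = ≮⇒≥ b≮d , ≮⇒≥ a≮b , a<c
... | true  | _ | _     | _ | _     | _     | _     | _ | _     = ⊥-elim so
... | false | _ | false | _ | _     | _     | _     | _ | _     = ⊥-elim so
... | false | _ | true  | _ | true  | _     | _     | _ | _     = ⊥-elim so
... | false | _ | true  | _ | false | false | _     | _ | _     = ⊥-elim so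
... | false | _ | true  | _ | false | true  | true  | _ | _     = ⊥-elim so
... | false | _ | true  | _ | false | true  | false | _ | true  = ⊥-elim so

-- Pattern avoidance

-- An occurrence is recorded by the comparisons that imply all the others: a < c ≤ b for 132 and
-- d ≤ b ≤ a < c for 3241 (non-strict, since sameOrderᵇ only tests _<ᵇ_).
Avoids132 : List ℕ → Set
Avoids132 π = ∀ {a b c} → (a ∷ b ∷ c ∷ []) ⊆ π → a < c → c ≤ b → ⊥

Avoids3241 : List ℕ → Set
Avoids3241 π = ∀ {a b c d} → (a ∷ b ∷ c ∷ d ∷ []) ⊆ π → d ≤ b → b ≤ a → a < c → ⊥

AvoidsIncreasing : ℕ → List ℕ → Set
AvoidsIncreasing k π = ∀ {s} → s ⊆ π → Increasing s → length s < k

Avoids : ℕ → List ℕ → Set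
Avoids k π = Avoids132 π × Avoids3241 π × AvoidsIncreasing k π

μ-increasing : ∀ k → Increasing (μ 0 k)
μ-increasing k = AllPairsₚ.map⁺ (AllPairsₚ.applyUpTo⁺₁ id k (λ i<j _ → s≤s i<j))

length-μ : ∀ k → length (μ 0 k) ≡ k
length-μ k = trans (length-map suc (upTo k)) (length-upTo k)

avoids132⁺ : ∀ {π} → ¬ T (containsᵇ π p132) → Avoids132 π
avoids132⁺ ¬c s⊆π a<c c≤b = ¬c (containsᵇ⁺ s⊆π (sameOrder-132⁺ a<c c≤b))

avoids132⁻ : ∀ {π} → Avoids132 π → ¬ T (containsᵇ π p132)
avoids132⁻ {π} av c with s , s⊆π , so ← containsᵇ⁻ π c = occurrence s s⊆π so (sameOrder⇒length≡ s p132 so)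
  where
  occurrence : ∀ s → s ⊆ π → T (sameOrderᵇ s p132) → length s ≡ 3 → ⊥
  occurrence (a ∷ b ∷ c ∷ []) s⊆π so _ with a<c , c≤b ← sameOrder-132⁻ so = av s⊆π a<c c≤b
  occurrence []                    _ _ ()
  occurrence (_ ∷ [])              _ _ ()
  occurrence (_ ∷ _ ∷ [])          _ _ ()
  occurrence (_ ∷ _ ∷ _ ∷ _ ∷ _)   _ _ ()

avoids3241⁺ : ∀ {π} → ¬ T (containsᵇ π p3241) → Avoids3241 π
avoids3241⁺ ¬c s⊆π d≤b b≤a a<c = ¬c (containsᵇ⁺ s⊆π (sameOrder-3241⁺ d≤b b≤a a<c))

avoids3241⁻ : ∀ {π} → Avoids3241 π → ¬ T (containsᵇ π p3241)
avoids3241⁻ {π} av c with s , s⊆π , so ← containsᵇ⁻ π c = occurrence s s⊆π so (sameOrder⇒length≡ s p3241 so)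
  where
  occurrence : ∀ s → s ⊆ π → T (sameOrderᵇ s p3241) → length s ≡ 4 → ⊥
  occurrence (a ∷ b ∷ c ∷ d ∷ []) s⊆π so _ with d≤b , b≤a , a<c ← sameOrder-3241⁻ so = av s⊆π d≤b b≤a a<c
  occurrence []                      _ _ ()
  occurrence (_ ∷ [])                _ _ ()
  occurrence (_ ∷ _ ∷ [])            _ _ ()
  occurrence (_ ∷ _ ∷ _ ∷ [])        _ _ ()
  occurrence (_ ∷ _ ∷ _ ∷ _ ∷ _ ∷ _) _ _ ()

avoidsIncreasing⁺ : ∀ {π} k → ¬ T (containsᵇ π (μ 0 k)) → AvoidsIncreasing k π
avoidsIncreasing⁺ k ¬c {s} s⊆π s↑ with length s <? k
... | yes s<k = s<k
... | no  s≮k = ⊥-elim (¬c (containsᵇ⁺ (⊆-trans (take-⊆ k s) s⊆π)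
                  (sameOrder-increasing⁺ length-prefix (AllPairsₚ.take⁺ k s↑) (μ-increasing k))))
  where
  length-prefix : length (take k s) ≡ length (μ 0 k)
  length-prefix = trans (length-take k s) (trans (m≤n⇒m⊓n≡m (≮⇒≥ s≮k)) (sym (length-μ k)))

avoidsIncreasing⁻ : ∀ {π} k → AvoidsIncreasing k π → ¬ T (containsᵇ π (μ 0 k))
avoidsIncreasing⁻ {π} k av c with s , s⊆π , so ← containsᵇ⁻ π c =
  <-irrefl (trans (sameOrder⇒length≡ s (μ 0 k) so) (length-μ k))
           (av s⊆π (sameOrder-increasing⁻ (μ-increasing k) so))

forbidden : ℕ → List (List ℕ)
forbidden k = p132 ∷ p3241 ∷ μ 0 k ∷ []

avoidsAllᵇ⇒Avoids : ∀ k π → T (avoidsAllᵇ π (forbidden k)) → Avoids k π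
avoidsAllᵇ⇒Avoids k π t with c132 ∷ c3241 ∷ cInc ∷ [] ← Allₚ.all⁺ (λ σ → not (containsᵇ π σ)) (forbidden k) t =
  avoids132⁺ (T-not⇒¬T c132) , avoids3241⁺ (T-not⇒¬T c3241) , avoidsIncreasing⁺ k (T-not⇒¬T cInc)

Avoids⇒avoidsAllᵇ : ∀ k π → Avoids k π → T (avoidsAllᵇ π (forbidden k))
Avoids⇒avoidsAllᵇ k π (av132 , av3241 , avInc) = Allₚ.all⁻ (λ σ → not (containsᵇ π σ))
  (¬T⇒T-not (avoids132⁻ av132) ∷ ¬T⇒T-not (avoids3241⁻ av3241) ∷ ¬T⇒T-not (avoidsIncreasing⁻ k avInc) ∷ [])

avoids-⊆ : ∀ {k s π} → s ⊆ π → Avoids k π → Avoids k s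
avoids-⊆ s⊆π (av132 , av3241 , avInc) =
  (λ t⊆s → av132 (⊆-trans t⊆s s⊆π)) ,
  (λ t⊆s → av3241 (⊆-trans t⊆s s⊆π)) ,
  (λ t⊆s → avInc (⊆-trans t⊆s s⊆π))

avoids-∷ʳ : ∀ {k α x} → All (_< x) α → Avoids k α → Avoids (suc k) (α ++ [ x ])
avoids-∷ʳ {k} {α} {x} α<x (av132 , av3241 , avInc) = av132′ , av3241′ , avInc′
  where
  av132′ : Avoids132 (α ++ [ x ])
  av132′ s⊆ a<c c≤b with ⊆-∷ʳ⁻ α s⊆
  ... | inj₁ s⊆α = av132 s⊆α a<c c≤b
  ... | inj₂ (s′ , eq , s′⊆α) with refl , refl ← ∷ʳ-injective (_ ∷ _ ∷ []) s′ eq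
                             with _ ∷ b<x ∷ [] ← All-resp-⊆ s′⊆α α<x = <⇒≱ b<x c≤b
  av3241′ : Avoids3241 (α ++ [ x ])
  av3241′ s⊆ d≤b b≤a a<c with ⊆-∷ʳ⁻ α s⊆
  ... | inj₁ s⊆α = av3241 s⊆α d≤b b≤a a<c
  ... | inj₂ (s′ , eq , s′⊆α) with refl , refl ← ∷ʳ-injective (_ ∷ _ ∷ _ ∷ []) s′ eq
                             with _ ∷ b<x ∷ _ ∷ [] ← All-resp-⊆ s′⊆α α<x = <⇒≱ b<x d≤b
  avInc′ : AvoidsIncreasing (suc k) (α ++ [ x ])
  avInc′ s⊆ s↑ with ⊆-∷ʳ⁻ α s⊆
  ... | inj₁ s⊆α = m<n⇒m<1+n (avInc s⊆α s↑)
  ... | inj₂ (s′ , refl , s′⊆α) =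
    subst (_< suc k) (sym (trans (length-++ s′) (+-comm (length s′) 1)))
      (s≤s (avInc s′⊆α (AllPairs-resp-⊆ (++⁺ʳ [ x ] ⊆-refl) s↑)))

avoids-∷ʳ⁻ : ∀ {k α x} → All (_< x) α → Avoids (suc k) (α ++ [ x ]) → Avoids k α
avoids-∷ʳ⁻ {k} {α} {x} α<x avoids with av132 , av3241 , _ ← avoids-⊆ (++⁺ʳ [ x ] ⊆-refl) avoids =
  av132 , av3241 , λ {s} s⊆α s↑ → s≤s⁻¹ (subst (_< suc k) (trans (length-++ s) (+-comm (length s) 1))
    (proj₂ (proj₂ avoids) (++⁺ s⊆α ⊆-refl)
      (AllPairsₚ.++⁺ s↑ ([] ∷ []) (All.map (_∷ []) (All-resp-⊆ s⊆α α<x)))))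

avoids-interval++ : ∀ {b m k β} → k < b → All (_≤ m) β → Avoids b β → Avoids b (interval (suc m) k ++ β)
avoids-interval++ {b} {m} {k} {β} k<b β≤m (av132 , av3241 , avInc) = av132′ , av3241′ , avInc′
  where
  run = interval (suc m) k
  m<run : All (m <_) run
  m<run = All.map proj₁ (interval-InRange (suc m) k)
  run↑ : Increasing run
  run↑ = interval-increasing (suc m) k
  av132′ : Avoids132 (run ++ β)
  av132′ s⊆ a<c c≤b with ⊆-++⁻ run s⊆
  ... | [] , _ , refl , _ , s⊆β = av132 s⊆β a<c c≤b
  ... | _ ∷ [] , _ , refl , s₁⊆ , s₂⊆
      with m<a ∷ [] ← All-resp-⊆ s₁⊆ m<run | _ ∷ c≤m ∷ [] ← All-resp-⊆ s₂⊆ β≤m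
      = <-asym (<-≤-trans a<c c≤m) m<a
  ... | _ ∷ _ ∷ [] , _ , refl , s₁⊆ , s₂⊆
      with m<a ∷ _ ← All-resp-⊆ s₁⊆ m<run | c≤m ∷ [] ← All-resp-⊆ s₂⊆ β≤m = <-asym (<-≤-trans a<c c≤m) m<a
  ... | _ ∷ _ ∷ _ ∷ [] , [] , refl , s₁⊆ , _
      with _ ∷ (b<c ∷ []) ∷ _ ← AllPairs-resp-⊆ s₁⊆ run↑ = <⇒≱ b<c c≤b
  ... | _ ∷ _ ∷ _ ∷ [] , _ ∷ _ , () , _ , _
  ... | _ ∷ _ ∷ _ ∷ _ ∷ _ , _ , () , _ , _
  av3241′ : Avoids3241 (run ++ β)
  av3241′ s⊆ d≤b b≤a a<c with ⊆-++⁻ run s⊆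
  ... | [] , _ , refl , _ , s⊆β = av3241 s⊆β d≤b b≤a a<c
  ... | _ ∷ [] , _ , refl , s₁⊆ , s₂⊆
      with m<a ∷ [] ← All-resp-⊆ s₁⊆ m<run | _ ∷ c≤m ∷ _ ← All-resp-⊆ s₂⊆ β≤m
      = <-asym (<-≤-trans a<c c≤m) m<a
  ... | _ ∷ _ ∷ _ , _ , eq , s₁⊆ , _
      with refl , eq′ ← ∷-injective eq
      with refl , _ ← ∷-injective eq′
      with (a<b ∷ _) ∷ _ ← AllPairs-resp-⊆ s₁⊆ run↑ = <⇒≱ a<b b≤a
  avInc′ : AvoidsIncreasing b (run ++ β)
  avInc′ s⊆ s↑ with ⊆-++⁻ run s⊆
  ... | s₁ , [] , refl , s₁⊆ , _ = begin-strict
    length (s₁ ++ [])  ≡⟨ cong length (++-identityʳ s₁) ⟩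
    length s₁          ≤⟨ length-mono-≤ s₁⊆ ⟩
    length run         ≡⟨ length-interval (suc m) k ⟩
    k                  <⟨ k<b ⟩
    b                  ∎
    where open ≤-Reasoning
  ... | [] , _ , refl , _ , s⊆β = avInc s⊆β s↑
  ... | _ ∷ s₁′ , _ ∷ _ , refl , s₁⊆ , s₂⊆
      with m<x ∷ _ ← All-resp-⊆ s₁⊆ m<run | y≤m ∷ _ ← All-resp-⊆ s₂⊆ β≤m | x<s ∷ _ ← s↑ = ⊥-elim (
    <-asym (<-≤-trans (All.lookup x<s (∈-++⁺ʳ s₁′ (here refl))) y≤m) m<x)

avoidsIncreasing-1⇒[] : ∀ {π} → AvoidsIncreasing 1 π → π ≡ []
avoidsIncreasing-1⇒[] {[]}    _     = refl
avoidsIncreasing-1⇒[] {x ∷ π} avInc = ⊥-elim (<-irrefl refl (avInc (refl ∷ minimum π) ([] ∷ [])))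

-- Permutations

IsPermutation : ℕ → List ℕ → Set
IsPermutation n π = length π ≡ n × All (InRange 1 (suc n)) π × Unique π

∈-words⁻ : ∀ m k {w} → w ∈ words m k → length w ≡ k × All (InRange 1 (suc m)) w
∈-words⁻ m zero    (here refl) = refl , []
∈-words⁻ m (suc k) w∈
  with w , w∈words , w∈block ← find (∈-concatMap⁻ _ {xs = words m k} w∈)
  with _ , x∈ , refl ← ∈-map⁻ _ w∈block
  with i , i∈ , refl ← ∈-map⁻ suc x∈
  with length-w , bounds ← ∈-words⁻ m k w∈words
  = cong suc length-w , (s≤s z≤n , s≤s (∈-upTo⁻ i∈)) ∷ bounds

∈-words⁺ : ∀ m k {w} → length w ≡ k → All (InRange 1 (suc m)) w → w ∈ words m k
∈-words⁺ m zero    {[]}          _ _                          = here refl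
∈-words⁺ m (suc k) {suc i ∷ w} l ((_ , s≤s i<m) ∷ bounds) =
  ∈-concatMap⁺ _ (Any.map (λ { refl → ∈-map⁺ _ (∈-map⁺ suc (∈-upTo⁺ i<m)) })
                          (∈-words⁺ m k (suc-injective l) bounds))

unique-words : ∀ m k → Unique (words m k)
unique-words m zero    = [] ∷ []
unique-words m (suc k) = unique-concatMap _ (drop 1) (unique-words m k)
  (λ _ → Unique.map⁺ ∷-injectiveˡ (Unique.map⁺ suc-injective (Unique.upTo⁺ m)))
  (λ _ z∈ → let _ , _ , z≡ = ∈-map⁻ _ z∈ in cong (drop 1) z≡)

distinctᵇ⇒Unique : ∀ xs → T (distinctᵇ xs) → Unique xs
distinctᵇ⇒Unique []       _ = []
distinctᵇ⇒Unique (x ∷ xs) t with fresh , rest ← Equivalence.to T-∧ t =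
  All.tabulate (λ y∈ x≡y → T-not⇒¬T fresh (any⁺ _ (Any.map (λ y≡z → ≡⇒≡ᵇ x _ (trans x≡y y≡z)) y∈)))
  ∷ distinctᵇ⇒Unique xs rest

Unique⇒distinctᵇ : ∀ xs → Unique xs → T (distinctᵇ xs)
Unique⇒distinctᵇ []       _          = tt
Unique⇒distinctᵇ (x ∷ xs) (x∉ ∷ xs!) = Equivalence.from T-∧ (¬T⇒T-not fresh , Unique⇒distinctᵇ xs xs!)
  where
  fresh : ¬ T (any (x ≡ᵇ_) xs)
  fresh t with z , z∈ , x≡ᵇz ← find (any⁻ _ xs t) = All.lookup x∉ z∈ (≡ᵇ⇒≡ x z x≡ᵇz)

∈-S⁻ : ∀ n {π} → π ∈ S n → IsPermutation n π
∈-S⁻ n {π} π∈ with π∈words , distinct ← ∈-filter⁻ (T? ∘ distinctᵇ) π∈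
  with length-π , bounds ← ∈-words⁻ n n π∈words = length-π , bounds , distinctᵇ⇒Unique π distinct

∈-S⁺ : ∀ n {π} → IsPermutation n π → π ∈ S n
∈-S⁺ n {π} (length-π , bounds , π!) =
  ∈-filter⁺ (T? ∘ distinctᵇ) (∈-words⁺ n n length-π bounds) (Unique⇒distinctᵇ π π!)

unique-S : ∀ n → Unique (S n)
unique-S n = Unique.filter⁺ (T? ∘ distinctᵇ) (unique-words n n)

avoiders : ℕ → ℕ → List (List ℕ)
avoiders k n = filterᵇ (λ π → avoidsAllᵇ π (forbidden k)) (S n)

∈-avoiders⁻ : ∀ k n {π} → π ∈ avoiders k n → IsPermutation n π × Avoids k π
∈-avoiders⁻ k n {π} π∈ with π∈S , avoids ← ∈-filter⁻ (T? ∘ λ π → avoidsAllᵇ π (forbidden k)) π∈ =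
  ∈-S⁻ n π∈S , avoidsAllᵇ⇒Avoids k π avoids

∈-avoiders⁺ : ∀ k n {π} → IsPermutation n π → Avoids k π → π ∈ avoiders k n
∈-avoiders⁺ k n {π} perm avoids =
  ∈-filter⁺ (T? ∘ λ π → avoidsAllᵇ π (forbidden k)) (∈-S⁺ n perm) (Avoids⇒avoidsAllᵇ k π avoids)

unique-avoiders : ∀ k n → Unique (avoiders k n)
unique-avoiders k n = Unique.filter⁺ (T? ∘ λ π → avoidsAllᵇ π (forbidden k)) (unique-S n)

no-avoiders-of-1 : ∀ n {π} → π ∉ avoiders 1 (suc n)
no-avoiders-of-1 n π∈ with (length-π , _) , (_ , _ , avInc) ← ∈-avoiders⁻ 1 (suc n) π∈ =
  0≢1+n (trans (cong length (sym (avoidsIncreasing-1⇒[] avInc))) length-π)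

isPermutation-∷ʳ : ∀ {n α} → IsPermutation n α → IsPermutation (suc n) (α ++ [ suc n ])
isPermutation-∷ʳ {n} {α} (length-α , bounds , α!) =
  trans (length-++ α) (trans (+-comm (length α) 1) (cong suc length-α)) ,
  Allₚ.++⁺ (All.map (λ (1≤x , x<) → 1≤x , m<n⇒m<1+n x<) bounds) ((s≤s z≤n , ≤-refl) ∷ []) ,
  Unique.++⁺ α! ([] ∷ []) λ { (x∈α , here refl) → <-irrefl refl (proj₂ (All.lookup bounds x∈α)) ; (_ , there ()) }

isPermutation-interval++ : ∀ {n m β} → m < n → IsPermutation m β → IsPermutation n (interval (suc m) (n ∸ m) ++ β)
isPermutation-interval++ {n} {m} {β} m<n (length-β , bounds , β!) =
  trans (length-++ run) (trans (cong₂ _+_ (length-interval (suc m) (n ∸ m)) length-β) (m∸n+n≡m (<⇒≤ m<n))) ,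
  Allₚ.++⁺ (All.map (λ (m<x , x<) → <-≤-trans z<s m<x , <-≤-trans x< (≤-reflexive (cong suc (m+[n∸m]≡n (<⇒≤ m<n)))))
                    (interval-InRange (suc m) (n ∸ m)))
           (All.map (λ (1≤y , y<) → 1≤y , <-≤-trans y< (s≤s (<⇒≤ m<n))) bounds) ,
  Unique.++⁺ (AllPairs.map <⇒≢ (interval-increasing (suc m) (n ∸ m))) β!
    λ (x∈run , x∈β) → <⇒≱ (proj₁ (All.lookup (interval-InRange (suc m) (n ∸ m)) x∈run))
                          (s≤s⁻¹ (proj₂ (All.lookup bounds x∈β)))
  where run = interval (suc m) (n ∸ m)

isPermutation-delete-max : ∀ {n} α β → IsPermutation (suc n) (α ++ suc n ∷ β) → IsPermutation n (α ++ β)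
isPermutation-delete-max {n} α β (length-π , bounds , π!) =
  suc-injective (trans (sym (length-++-sucʳ α (suc n) β)) length-π) ,
  All.zipWith (λ ((1≤x , x<) , n≢x) → 1≤x , ≤∧≢⇒< (s≤s⁻¹ x<) (n≢x ∘ sym))
              (All-resp-⊆ deletion bounds , unique-middle α π!) ,
  AllPairs-resp-⊆ deletion π!
  where
  deletion : α ++ β ⊆ α ++ suc n ∷ β
  deletion = ++⁺ ⊆-refl (suc n ∷ʳ ⊆-refl)

max-∈ : ∀ {n π} → IsPermutation (suc n) π → suc n ∈ π
max-∈ {n} {π} (length-π , bounds , π!) with suc n ∈? π
... | yes n∈π = n∈π
... | no  n∉π = ⊥-elim (<⇒≱ (m<m+n (suc n) z<s) (begin
  suc n + 1       ≡⟨ cong (_+ 1) length-π ⟨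
  length π + 1    ≤⟨ length-unique-in-range (s≤s z≤n) π! below-max ⟩
  suc n           ∎))
  where
  open ≤-Reasoning
  below-max : All (InRange 1 (suc n)) π
  below-max = All.tabulate λ x∈ → let 1≤x , x< = All.lookup bounds x∈ in
    1≤x , ≤∧≢⇒< (s≤s⁻¹ x<) (λ { refl → n∉π x∈ })

-- Decomposition at the maximal entry

-- The block i holds the permutations (m+1 … n+1) β with β of length m = i + 1 and a run shorter than b.
runBlock : ℕ → ℕ → ℕ → List (List ℕ)
runBlock b n i = if n ∸ i <ᵇ b then map (interval (2 + i) (n ∸ i) ++_) (avoiders b (suc i)) else []

candidates : ℕ → ℕ → List (List ℕ)
candidates b n = map (_++ [ suc n ]) (avoiders b n) ++ concatMap (runBlock (suc b) n) (upTo n)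

∈-runBlock⁻ : ∀ b n i {π} → π ∈ runBlock b n i →
              T (n ∸ i <ᵇ b) × ∃[ β ] π ≡ interval (2 + i) (n ∸ i) ++ β × β ∈ avoiders b (suc i)
∈-runBlock⁻ b n i π∈ with n ∸ i <ᵇ b
... | true with β , β∈ , refl ← ∈-map⁻ _ π∈ = tt , β , refl , β∈

∈-runBlock⁺ : ∀ b n i {β} → T (n ∸ i <ᵇ b) → β ∈ avoiders b (suc i) →
              interval (2 + i) (n ∸ i) ++ β ∈ runBlock b n i
∈-runBlock⁺ b n i short β∈ with n ∸ i <ᵇ b
... | true = ∈-map⁺ _ β∈

candidates⊆avoiders : ∀ b n {π} → π ∈ candidates b n → π ∈ avoiders (suc b) (suc n)
candidates⊆avoiders b n π∈ with ∈-++⁻ (map (_++ [ suc n ]) (avoiders b n)) π∈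
... | inj₁ π∈maxLast
  with α , α∈ , refl ← ∈-map⁻ _ π∈maxLast
  with perm , avoids ← ∈-avoiders⁻ b n α∈
  = ∈-avoiders⁺ (suc b) (suc n) (isPermutation-∷ʳ perm) (avoids-∷ʳ (All.map proj₂ (proj₁ (proj₂ perm))) avoids)
... | inj₂ π∈runs
  with i , i∈ , π∈block ← find (∈-concatMap⁻ _ {xs = upTo n} π∈runs)
  with short , β , refl , β∈ ← ∈-runBlock⁻ (suc b) n i π∈block
  with perm , avoids ← ∈-avoiders⁻ (suc b) (suc i) β∈
  = ∈-avoiders⁺ (suc b) (suc n) (isPermutation-interval++ (s≤s (∈-upTo⁻ i∈)) perm)
      (avoids-interval++ (<ᵇ⇒< _ _ short) (All.map (s≤s⁻¹ ∘ proj₂) (proj₁ (proj₂ perm))) avoids)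

module MaxNotLast {b n : ℕ} (α : List ℕ) (y : ℕ) (β′ : List ℕ)
                 (perm : IsPermutation (suc n) (α ++ suc n ∷ y ∷ β′))
                 (avoids : Avoids (suc b) (α ++ suc n ∷ y ∷ β′)) where

  β : List ℕ
  β = y ∷ β′

  m : ℕ
  m = length β

  length-α+m : length α + m ≡ n
  length-α+m = trans (sym (length-++ α)) (proj₁ (isPermutation-delete-max α β perm))

  m≤n : m ≤ n
  m≤n = subst (m ≤_) length-α+m (m≤n+m m (length α))

  α-bounds : All (InRange 1 (suc n)) α
  α-bounds = Allₚ.++⁻ˡ α (proj₁ (proj₂ (isPermutation-delete-max α β perm)))

  β-bounds : All (InRange 1 (suc n)) β
  β-bounds = Allₚ.++⁻ʳ α (proj₁ (proj₂ (isPermutation-delete-max α β perm)))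

  α++β! : Unique (α ++ β)
  α++β! = proj₂ (proj₂ (isPermutation-delete-max α β perm))

  β-below-α : ∀ {x z} → x ∈ α → z ∈ β → z < x
  β-below-α {x} {z} x∈ z∈ with x <? z
  ... | no  x≮z = ≤∧≢⇒< (≮⇒≥ x≮z) (AllPairs-++-cross α α++β! x∈ z∈ ∘ sym)
  ... | yes x<z = ⊥-elim (proj₁ avoids (++⁺ (from∈ x∈) (refl ∷ from∈ z∈)) x<z (<⇒≤ z<n))
    where z<n = proj₂ (All.lookup β-bounds z∈)

  α-above : All (m <_) α
  α-above = All.tabulate λ {x} x∈ →
    subst (_≤ x) (+-comm m 1)
      (length-unique-in-range (proj₁ (All.lookup α-bounds x∈)) (AllPairs-resp-⊆ (++⁺ˡ α ⊆-refl) α++β!)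
        (All.tabulate λ z∈ → proj₁ (All.lookup β-bounds z∈) , β-below-α x∈ z∈))

  β-below : All (_≤ m) β
  β-below = All.tabulate λ {z} z∈ → s≤s⁻¹ (+-cancelˡ-≤ (length α) _ _ (begin
    length α + suc z    ≤⟨ length-unique-in-range (proj₂ (All.lookup β-bounds z∈))
                             (AllPairs-resp-⊆ (++⁺ʳ β ⊆-refl) α++β!)
                             (All.tabulate λ x∈ → β-below-α x∈ z∈ , proj₂ (All.lookup α-bounds x∈)) ⟩
    suc n               ≡⟨ cong suc length-α+m ⟨
    suc (length α + m)  ≡⟨ +-suc (length α) m ⟨
    length α + suc m    ∎))
    where open ≤-Reasoning

  α-increasing : Increasing α
  α-increasing = pairs⇒AllPairs ordered
    where
    ordered : ∀ {x z} → (x ∷ z ∷ []) ⊆ α → x < z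
    ordered {x} {z} xz⊆α with x <? z
    ... | yes x<z = x<z
    ... | no  x≮z = ⊥-elim (proj₁ (proj₂ avoids) (++⁺ xz⊆α (refl ∷ refl ∷ minimum β′))
                      (<⇒≤ (β-below-α z∈ (here refl))) (≮⇒≥ x≮z) (proj₂ (All.lookup α-bounds x∈)))
      where
      x∈ = lookup xz⊆α (here refl)
      z∈ = lookup xz⊆α (there (here refl))

  α≡interval : α ≡ interval (suc m) (n ∸ m)
  α≡interval = increasing⇒interval (suc m) (n ∸ m) α-increasing
    (All.zipWith (λ (m<x , _ , x<) → m<x , <-≤-trans x< (≤-reflexive (cong suc (sym (m+[n∸m]≡n m≤n)))))
                 (α-above , α-bounds))
    (trans (sym (m+n∸n≡m (length α) m)) (cong (_∸ m) length-α+m))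

  π≡run++β : α ++ suc n ∷ β ≡ interval (suc m) (suc n ∸ m) ++ β
  π≡run++β = begin
    α ++ suc n ∷ β
      ≡⟨ ++-assoc α [ suc n ] β ⟨
    (α ++ [ suc n ]) ++ β
      ≡⟨ cong (λ t → (t ++ [ suc n ]) ++ β) α≡interval ⟩
    (interval (suc m) (n ∸ m) ++ [ suc n ]) ++ β
      ≡⟨ cong (λ t → (interval (suc m) (n ∸ m) ++ [ suc t ]) ++ β) (m+[n∸m]≡n m≤n) ⟨
    (interval (suc m) (n ∸ m) ++ [ suc m + (n ∸ m) ]) ++ β
      ≡⟨ cong (_++ β) (interval-∷ʳ (suc m) (n ∸ m)) ⟩
    interval (suc m) (suc (n ∸ m)) ++ β
      ≡⟨ cong (λ t → interval (suc m) t ++ β) (+-∸-assoc 1 m≤n) ⟨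
    interval (suc m) (suc n ∸ m) ++ β
      ∎
    where open ≡-Reasoning

  run-short : suc n ∸ m < suc b
  run-short = subst (_< suc b) (length-interval (suc m) (suc n ∸ m))
    (proj₂ (proj₂ avoids) (subst (interval (suc m) (suc n ∸ m) ⊆_) (sym π≡run++β) (++⁺ʳ β ⊆-refl))
                          (interval-increasing (suc m) (suc n ∸ m)))

  β∈avoiders : β ∈ avoiders (suc b) m
  β∈avoiders = ∈-avoiders⁺ (suc b) m
    (refl ,
     All.zipWith (λ ((1≤z , _) , z≤m) → 1≤z , s≤s z≤m) (β-bounds , β-below) ,
     AllPairs-resp-⊆ (++⁺ˡ α ⊆-refl) α++β!)
    (avoids-⊆ (++⁺ˡ α (suc n ∷ʳ ⊆-refl)) avoids)

avoiders⊆candidates : ∀ b n {π} → π ∈ avoiders (suc b) (suc n) → π ∈ candidates b n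
avoiders⊆candidates b n π∈
  with perm , avoids ← ∈-avoiders⁻ (suc b) (suc n) π∈
  with α , β , refl ← ∈-∃++ (max-∈ perm)
  = split-at-max α β perm avoids
  where
  split-at-max : ∀ α β → IsPermutation (suc n) (α ++ suc n ∷ β) → Avoids (suc b) (α ++ suc n ∷ β) →
                 α ++ suc n ∷ β ∈ candidates b n
  split-at-max α [] perm avoids = ∈-++⁺ˡ (∈-map⁺ _ (∈-avoiders⁺ b n
    (subst (IsPermutation n) (++-identityʳ α) rest)
    (avoids-∷ʳ⁻ (All.map proj₂ (Allₚ.++⁻ˡ α (proj₁ (proj₂ rest)))) avoids)))
    where rest = isPermutation-delete-max α [] perm
  split-at-max α (y ∷ β′) perm avoids =
    subst (_∈ candidates b n) (sym π≡run++β) (∈-++⁺ʳ (map (_++ [ suc n ]) (avoiders b n))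
      (∈-concatMap⁺ _ (Any.map (λ { refl → ∈-runBlock⁺ (suc b) n (length β′) (<⇒<ᵇ run-short) β∈avoiders })
                               (∈-upTo⁺ m≤n))))
    where open MaxNotLast α y β′ perm avoids

unique-candidates : ∀ b n → Unique (candidates b n)
unique-candidates b n = Unique.++⁺
  (Unique.map⁺ (∷ʳ-injectiveˡ _ _) (unique-avoiders b n))
  (unique-concatMap (runBlock (suc b) n) (λ π → first π ∸ 2) (Unique.upTo⁺ n) block! block-index)
  disjoint
  where
  -- Run blocks are told apart by their first entry, the two halves by their last entry.
  first : List ℕ → ℕ
  first []      = 0
  first (x ∷ _) = x
  block! : ∀ {i} → i ∈ upTo n → Unique (runBlock (suc b) n i)
  block! {i} _ with n ∸ i <ᵇ suc b
  ... | true  = Unique.map⁺ (++-cancelˡ (interval (2 + i) (n ∸ i)) _ _) (unique-avoiders (suc b) (suc i))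
  ... | false = []
  block-index : ∀ {i π} → i ∈ upTo n → π ∈ runBlock (suc b) n i → first π ∸ 2 ≡ i
  block-index {i} i∈ π∈ with _ , β , refl , _ ← ∈-runBlock⁻ (suc b) n i π∈ with n ∸ i | m<n⇒0<n∸m (∈-upTo⁻ i∈)
  ... | suc _ | _ = refl
  max-not-last : ∀ {i} β → i < n → All (InRange 1 (suc (suc i))) β → length β ≡ suc i →
                 last (interval (2 + i) (n ∸ i) ++ β) ≢ just (suc n)
  max-not-last {i} (y ∷ β′) i<n bounds _ last≡ = <⇒≱ i<n (s≤s⁻¹ (s≤s⁻¹ (proj₂ (All.lookup bounds n∈β))))
    where n∈β = last-∈ (y ∷ β′) (trans (sym (last-++ (interval (2 + i) (n ∸ i)))) last≡)
  disjoint : Disjoint (map (_++ [ suc n ]) (avoiders b n)) (concatMap (runBlock (suc b) n) (upTo n))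
  disjoint (π∈maxLast , π∈runs)
    with α , _ , refl ← ∈-map⁻ _ π∈maxLast
    with i , i∈ , π∈block ← find (∈-concatMap⁻ _ π∈runs)
    with _ , β , eq , β∈ ← ∈-runBlock⁻ (suc b) n i π∈block
    with (length-β , bounds , _) , _ ← ∈-avoiders⁻ (suc b) (suc i) β∈
    = max-not-last β (∈-upTo⁻ i∈) bounds length-β (trans (cong last (sym eq)) (last-++ α))

length-avoiders≡length-candidates : ∀ b n → length (avoiders (suc b) (suc n)) ≡ length (candidates b n)
length-avoiders≡length-candidates b n =
  ↭-length (∼bag⇒↭ (unique∧set⇒bag (unique-avoiders (suc b) (suc n)) (unique-candidates b n)
                                    (mk⇔ (avoiders⊆candidates b n) (candidates⊆avoiders b n))))

length-runBlock : ∀ b n i → length (runBlock b n i) ≡ (if n ∸ i <ᵇ b then length (avoiders b (suc i)) else 0)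
length-runBlock b n i with n ∸ i <ᵇ b
... | true  = length-map _ (avoiders b (suc i))
... | false = refl

runWeight : ℕ → ℕ → ℕ → ℤ
runWeight b n i = + (if n ∸ i <ᵇ b then length (avoiders b (suc i)) else 0)

length-concatMap-sumℤ : ∀ {A B : Set} (f : A → List B) xs →
                        + length (concatMap f xs) ≡ sumℤ (map (λ x → + length (f x)) xs)
length-concatMap-sumℤ f []       = refl
length-concatMap-sumℤ f (x ∷ xs) =
  trans (cong +_ (length-++ (f x))) (cong (λ t → + length (f x) ℤ.+ t) (length-concatMap-sumℤ f xs))

count-recursion : ∀ b n → + length (avoiders (suc b) (suc n)) ≡
                          + length (avoiders b n) ℤ.+ sumℤ (map (runWeight (suc b) n) (upTo n))
count-recursion b n = begin
  + length (avoiders (suc b) (suc n))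
    ≡⟨ cong +_ (trans (length-avoiders≡length-candidates b n) (length-++ maxLast)) ⟩
  + length maxLast ℤ.+ + length (concatMap (runBlock (suc b) n) (upTo n))
    ≡⟨ cong₂ ℤ._+_ (cong +_ (length-map _ (avoiders b n))) (length-concatMap-sumℤ (runBlock (suc b) n) (upTo n)) ⟩
  + length (avoiders b n) ℤ.+ sumℤ (map (λ i → + length (runBlock (suc b) n i)) (upTo n))
    ≡⟨ cong (λ xs → + length (avoiders b n) ℤ.+ sumℤ xs) (map-cong (cong +_ ∘ length-runBlock (suc b) n) (upTo n)) ⟩
  + length (avoiders b n) ℤ.+ sumℤ (map (runWeight (suc b) n) (upTo n)) ∎
  where
  open ≡-Reasoning
  maxLast = map (_++ [ suc n ]) (avoiders b n)

-- The generating function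

sumℤ-++ : ∀ xs ys → sumℤ (xs ++ ys) ≡ sumℤ xs ℤ.+ sumℤ ys
sumℤ-++ []       ys = sym (ℤ.+-identityˡ (sumℤ ys))
sumℤ-++ (x ∷ xs) ys = trans (cong (λ t → x ℤ.+ t) (sumℤ-++ xs ys)) (sym (ℤ.+-assoc x (sumℤ xs) (sumℤ ys)))

sumℤ-neg : ∀ (f : ℕ → ℤ) xs → sumℤ (map (ℤ.-_ ∘ f) xs) ≡ ℤ.- sumℤ (map f xs)
sumℤ-neg f []       = refl
sumℤ-neg f (x ∷ xs) = trans (cong (λ t → ℤ.- f x ℤ.+ t) (sumℤ-neg f xs)) (sym (ℤ.neg-distrib-+ (f x) (sumℤ (map f xs))))

sumℤ-zero : ∀ (xs : List ℕ) → sumℤ (map (λ _ → + 0) xs) ≡ + 0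
sumℤ-zero []       = refl
sumℤ-zero (_ ∷ xs) = trans (ℤ.+-identityˡ _) (sumℤ-zero xs)

sumℤ-upTo-suc : ∀ (f : ℕ → ℤ) n → sumℤ (map f (upTo (suc n))) ≡ f 0 ℤ.+ sumℤ (map (f ∘ suc) (upTo n))
sumℤ-upTo-suc f n = cong (λ xs → f 0 ℤ.+ sumℤ xs) (trans (map-applyUpTo suc f n) (sym (map-upTo (f ∘ suc) n)))

sumℤ-upTo-∷ʳ : ∀ (f : ℕ → ℤ) n → sumℤ (map f (upTo (suc n))) ≡ sumℤ (map f (upTo n)) ℤ.+ f n
sumℤ-upTo-∷ʳ f n = begin
  sumℤ (map f (upTo (suc n)))                ≡⟨ cong (sumℤ ∘ map f) (upTo-∷ʳ n) ⟨
  sumℤ (map f (upTo n ++ [ n ]))             ≡⟨ cong sumℤ (map-++ f (upTo n) [ n ]) ⟩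
  sumℤ (map f (upTo n) ++ [ f n ])           ≡⟨ sumℤ-++ (map f (upTo n)) [ f n ] ⟩
  sumℤ (map f (upTo n)) ℤ.+ (f n ℤ.+ + 0)    ≡⟨ cong (λ t → sumℤ (map f (upTo n)) ℤ.+ t) (ℤ.+-identityʳ (f n)) ⟩
  sumℤ (map f (upTo n)) ℤ.+ f n              ∎
  where open ≡-Reasoning

-j+[i+j]≡i : ∀ i j → ℤ.- j ℤ.+ (i ℤ.+ j) ≡ i
-j+[i+j]≡i i j = begin
  ℤ.- j ℤ.+ (i ℤ.+ j)    ≡⟨ ℤ.+-comm (ℤ.- j) (i ℤ.+ j) ⟩
  (i ℤ.+ j) ℤ.+ ℤ.- j    ≡⟨ ℤ.+-assoc i j (ℤ.- j) ⟩
  i ℤ.+ (j ℤ.+ ℤ.- j)    ≡⟨ cong (λ t → i ℤ.+ t) (ℤ.+-inverseʳ j) ⟩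
  i ℤ.+ + 0              ≡⟨ ℤ.+-identityʳ i ⟩
  i                      ∎
  where open ≡-Reasoning

module Coefficients (c n : ℕ) where

  f : FPS
  f = h 0 (suc c)

  term : ℕ → ℤ
  term k = (f ⊖ one) k ℤ.* D (suc c) (suc n ∸ k)

  runSum : ℤ
  runSum = sumℤ (map (runWeight (suc c) n) (upTo n))

  interior-term : ∀ {i} → i < n → term (suc i) ≡ ℤ.- runWeight (suc c) n i
  interior-term {i} i<n with n ∸ i | m<n⇒0<n∸m i<n
  ... | suc j | _ with suc j <ᵇ suc c
  ... | true  = trans (cong (ℤ._* ℤ.-[1+ 0 ]) (ℤ.+-identityʳ (f (suc i))))
                      (trans (ℤ.*-comm (f (suc i)) ℤ.-[1+ 0 ]) (ℤ.-1*i≡-i (f (suc i))))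
  ... | false = ℤ.*-zeroʳ ((f ⊖ one) (suc i))

  last-term : term (suc n) ≡ f (suc n)
  last-term = begin
    (f ⊖ one) (suc n) ℤ.* D (suc c) (n ∸ n)  ≡⟨ cong (λ k → (f ⊖ one) (suc n) ℤ.* D (suc c) k) (n∸n≡0 n) ⟩
    (f ⊖ one) (suc n) ℤ.* + 1                ≡⟨ ℤ.*-identityʳ _ ⟩
    f (suc n) ℤ.+ + 0                        ≡⟨ ℤ.+-identityʳ (f (suc n)) ⟩
    f (suc n)                                ∎
    where open ≡-Reasoning

  lhs≡avoiders : ((f ⊖ one) ⊛ D (suc c)) (suc n) ≡ + length (avoiders c n)
  lhs≡avoiders = begin
    -- the term k = 0 reduces to + 0, as f 0 = + 1 (only the empty permutation has length 0)
    ((f ⊖ one) ⊛ D (suc c)) (suc n)                            ≡⟨ sumℤ-upTo-suc term (suc n) ⟩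
    + 0 ℤ.+ sumℤ (map (term ∘ suc) (upTo (suc n)))             ≡⟨ ℤ.+-identityˡ _ ⟩
    sumℤ (map (term ∘ suc) (upTo (suc n)))                     ≡⟨ sumℤ-upTo-∷ʳ (term ∘ suc) n ⟩
    sumℤ (map (term ∘ suc) (upTo n)) ℤ.+ term (suc n)          ≡⟨ cong₂ ℤ._+_ interior-sum last-term ⟩
    ℤ.- runSum ℤ.+ f (suc n)                                   ≡⟨ cong (λ t → ℤ.- runSum ℤ.+ t) (count-recursion c n) ⟩
    ℤ.- runSum ℤ.+ (+ length (avoiders c n) ℤ.+ runSum)        ≡⟨ -j+[i+j]≡i (+ length (avoiders c n)) runSum ⟩
    + length (avoiders c n)                                    ∎
    where
    open ≡-Reasoning
    interior-sum : sumℤ (map (term ∘ suc) (upTo n)) ≡ ℤ.- runSum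
    interior-sum = trans (cong sumℤ (map-cong-local (All.tabulate (interior-term ∘ ∈-upTo⁻))))
                         (sumℤ-neg (runWeight (suc c) n) (upTo n))

  rhs≡avoiders : (X ⊛ h 0 c) (suc n) ≡ + length (avoiders c n)
  rhs≡avoiders = begin
    (X ⊛ h 0 c) (suc n)                                     ≡⟨ sumℤ-upTo-suc (λ k → X k ℤ.* h 0 c (suc n ∸ k)) (suc n) ⟩
    + 0 ℤ.+ sumℤ (map shifted (upTo (suc n)))               ≡⟨ ℤ.+-identityˡ _ ⟩
    sumℤ (map shifted (upTo (suc n)))                       ≡⟨ sumℤ-upTo-suc shifted n ⟩
    + 1 ℤ.* h 0 c n ℤ.+ sumℤ (map (λ _ → + 0) (upTo n))     ≡⟨ cong₂ ℤ._+_ (ℤ.*-identityˡ (h 0 c n)) (sumℤ-zero (upTo n)) ⟩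
    h 0 c n ℤ.+ + 0                                         ≡⟨ ℤ.+-identityʳ _ ⟩
    + length (avoiders c n)                                 ∎
    where
    open ≡-Reasoning
    shifted : ℕ → ℤ
    shifted i = X (suc i) ℤ.* h 0 c (n ∸ i)

h-0-suc-recursion : ∀ c → (h 0 (suc c) ⊖ one) ⊛ D (suc c) ≈ X ⊛ h 0 c
h-0-suc-recursion c zero    = refl
h-0-suc-recursion c (suc n) = trans lhs≡avoiders (sym rhs≡avoiders)
  where open Coefficients c n

h-0-1≈one : h 0 1 ≈ one
h-0-1≈one zero    = refl
h-0-1≈one (suc n) =
  cong +_ (n≤0⇒n≡0 (Unique⇒length≤ {ys = []} (unique-avoiders 1 (suc n)) (⊥-elim ∘ no-avoiders-of-1 n)))

mainTheorem15 : (h 0 1 ≈ one)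
    × (∀ (b : ℕ) → 2 ≤ b → (h 0 b ⊖ one) ⊛ D b ≈ X ⊛ h 0 (b Data.Nat.∸ 1))
mainTheorem15 = h-0-1≈one , λ { (suc (suc c)) (s≤s (s≤s z≤n)) → h-0-suc-recursion (suc c) }
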